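{- In the rate-assignment algorithm described in the context (with any parameter $\gamma\ge1$), for any time $t$ and any job $j$, all tasks in $T^t(j)$ freeze at the same moment $\tau$, and hence all receive the same rate $L^t_v$.
   Context: Machines have speeds $s_1\ge\dots\ge s_m>0$ and $S_k=s_1+\dots+s_k$ (with $S_k=S_m$ for $k>m$). Each job $j$ has weight $w_j>0$ and a set of tasks; $T^t(j)$ is the set of unfinished (alive) tasks of $j$ at time $t$. Rate assignment at time $t$ with parameter $\gamma$: raise a parameter $\tau$ (whose values are called moments) continuously from $0$; each unfrozen alive task $v\in T^t(j)$ has tentative rate $L^t_v=\frac{w_j}{|T^t(j)|}\tau$. Whenever some subset $V$ of alive tasks satisfies $\sum_{v\in V}L^t_v=\gamma S_{|V|}$, a maximal such set is picked and its tasks are frozen (their rates are fixed at the current values); then $\tau$ continues to increase for the remaining unfrozen tasks, until all alive tasks are frozen. Throughout, the rates satisfy $\sum_{v\in V}L^t_v\le\gamma S_{|V|}$ for every set $V$ of alive tasks.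
   Formalization: The machine speeds, the job weights $w_j$, the parameter γ and the moments τ all take values in the rationals. -}

module Defs where

open import Data.Bool using (Bool; true; false; if_then_else_)
open import Data.Nat as ℕ using (ℕ; zero; suc)
open import Data.Integer using (+_)
open import Data.Rational using (ℚ; 0ℚ; 1ℚ; _+_; _*_; _≤_; _<_; _/_)
open import Data.Fin using (Fin; toℕ)
open import Data.Fin.Properties using (_≟_)
open import Data.Fin.Subset using (Subset; ∣_∣; _∈_; _⊂_)
open import Data.Vec using (lookup)
open import Data.List using (List; foldr; take; tabulate; length; filter; allFin)
open import Data.Maybe using (Maybe; just; nothing; maybe)
open import Data.Product using (Σ; _×_; ∃)
open import Relation.Binary.PropositionalEquality using (_≡_)
open import Relation.Nullary using (¬_)

sumℚ : List ℚ → ℚ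
sumℚ = foldr _+_ 0ℚ

-- S_k = s_1 + ... + s_k  (and S_k = S_m for k > m, since take k returns the whole list)
S : ∀ {m} → (Fin m → ℚ) → ℕ → ℚ
S {m} s k = sumℚ (take k (tabulate s))

sumOver : ∀ {n} → Subset n → (Fin n → ℚ) → ℚ
sumOver {n} V f = sumℚ (tabulate (λ i → if lookup V i then f i else 0ℚ))

-- 1/k as a rational (k = 0 never occurs: each alive task counts itself)
inv : ℕ → ℚ
inv zero = 0ℚ
inv (suc k) = + 1 / suc k

-- An instance at a fixed time t: n alive tasks, the job of each alive task,
-- job weights, machine speeds and the parameter γ.
record Instance : Set where
  field
    m      : ℕ
    speed  : Fin m → ℚ
    nJobs  : ℕ
    weight : Fin nJobs → ℚ
    n      : ℕ
    job    : Fin n → Fin nJobs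
    γ      : ℚ

module _ (I : Instance) where
  open Instance I

  alive : Fin nJobs → ℕ
  alive j = length (filter (λ v → job v ≟ j) (allFin n))

  coef : Fin n → ℚ
  coef v = weight (job v) * inv (alive (job v))

  -- state: for each alive task, nothing (unfrozen) or just μ (frozen at moment μ)
  State : Set
  State = Fin n → Maybe ℚ

  rate : State → ℚ → Fin n → ℚ
  rate st τ v = coef v * maybe (λ μ → μ) τ (st v)

  Tight : State → ℚ → Subset n → Set
  Tight st τ V = sumOver V (rate st τ) ≡ γ * S speed ∣ V ∣

  HasUnfrozen : State → Subset n → Set
  HasUnfrozen st V = ∃ λ v → v ∈ V × st v ≡ nothing

  freeze : State → Subset n → ℚ → State
  freeze st V τ v with st v
  ... | just μ  = just μ
  ... | nothing = if lookup V v then just τ else nothing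

  data Step (st : State) (τ₀ : ℚ) : State → ℚ → Set where
    step : (τ : ℚ) (V : Subset n) →
           τ₀ ≤ τ →
           HasUnfrozen st V →
           Tight st τ V →
           (∀ τ' → τ₀ ≤ τ' → τ' < τ → ∀ V' → HasUnfrozen st V' → ¬ Tight st τ' V') →
           (∀ W → V ⊂ W → ¬ Tight st τ W) →
           Step st τ₀ (freeze st V τ) τ

  AllFrozen : State → Set
  AllFrozen st = ∀ v → Σ ℚ λ μ → st v ≡ just μ

  data Run : State → ℚ → State → Set where
    done : ∀ {st τ₀} → AllFrozen st → Run st τ₀ st
    next : ∀ {st τ₀ st' τ fin} → Step st τ₀ st' τ → Run st' τ fin → Run st τ₀ fin

  initial : State
  initial _ = nothing

  ValidInstance : Set
  ValidInstance =
    (∀ i → 0ℚ < speed i) ×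
    (∀ i k → toℕ i ℕ.≤ toℕ k → speed k ≤ speed i) ×
    (∀ j → 0ℚ < weight j) ×
    1ℚ ≤ γ

{-# OPTIONS --safe #-}
-- Two invariants hold along every run: the current rates are feasible (every set V of alive
-- tasks has total rate at most γ S_|V|), and tasks of the same job are in the same state.
-- Between freezing events the total rate of a set is affine in τ, so a set that became
-- overfull would have been tight, with an unfrozen task, at an earlier moment; hence
-- feasibility persists.  At a freezing moment the unfrozen tasks of one job share a rate r.
-- If a maximal tight set V contained one of them, u, but not another, v, then feasibility
-- of V ∖ {u} and concavity of k ↦ γ S_k (the speeds are non-increasing) would give
-- γ S_(|V|+1) ≤ γ S_|V| + r, making V ∪ {v} tight and contradicting maximality.
module Submission where

open import Defs
open import Algebra.Bundles using (CommutativeMonoid)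
open import Data.Bool using (true; false; if_then_else_)
open import Data.Nat as ℕ using (ℕ; zero; suc; z≤n)
open import Data.Rational
  using (ℚ; 0ℚ; 1ℚ; _+_; _*_; -_; _-_; _÷_; 1/_; _≤_; _<_; _≥_; _≤?_; NonZero; >-nonZero; nonNegative; nonPositive; positive)
open import Data.Rational.Properties
open import Data.Fin as Fin using (Fin; zero; suc)
open import Data.Fin.Subset using (Subset; ∣_∣; _∈_; _∉_; _⊆_; _⊂_; inside; outside)
open import Data.Fin.Subset.Properties using (_∈?_)
open import Data.Vec.Base using (_∷_; []; lookup; _[_]≔_; here; there)
open import Data.Vec.Properties using ([]≔-updates; []≔-minimal; []=⇒lookup; lookup⇒[]=)
open import Data.List.Properties using (tabulate-cong)
open import Data.Maybe using (just; nothing; maybe; maybe′)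
open import Data.Product using (_×_; _,_; ∃-syntax; map; map₁; map₂)
open import Data.Empty using (⊥-elim)
open import Function using (_∘_)
open import Relation.Binary.Core using (_Preserves_⟶_)
open import Relation.Binary.PropositionalEquality
open import Relation.Nullary using (¬_; yes; no; contradiction)

open import Algebra.Properties.Group +-0-group using (//-rightDividesˡ; //-rightDividesʳ)
open import Algebra.Properties.CommutativeSemigroup
  (CommutativeMonoid.commutativeSemigroup +-0-commutativeMonoid) using (interchange; x∙yz≈xz∙y)

+-cancelʳ-≤ : ∀ {p q} r → p + r ≤ q + r → p ≤ q
+-cancelʳ-≤ {p} {q} r p+r≤q+r = begin
  p           ≡⟨ //-rightDividesʳ r p ⟨
  p + r - r   ≤⟨ +-monoˡ-≤ (- r) p+r≤q+r ⟩
  q + r - r   ≡⟨ //-rightDividesʳ r q ⟩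
  q           ∎
  where open ≤-Reasoning

p+q≤r⇒q≤r-p : ∀ {p q r} → p + q ≤ r → q ≤ r - p
p+q≤r⇒q≤r-p {p} {q} {r} p+q≤r = +-cancelʳ-≤ p (begin
  q + p         ≡⟨ +-comm q p ⟩
  p + q         ≤⟨ p+q≤r ⟩
  r             ≡⟨ //-rightDividesˡ p r ⟨
  r - p + p     ∎)
  where open ≤-Reasoning

r<p+q⇒r-p<q : ∀ {p q r} → r < p + q → r - p < q
r<p+q⇒r-p<q {p} {q} {r} r<p+q = begin-strict
  r - p         <⟨ +-monoˡ-< (- p) r<p+q ⟩
  p + q - p     ≡⟨ cong (_- p) (+-comm p q) ⟩
  q + p - p     ≡⟨ //-rightDividesʳ p q ⟩
  q             ∎
  where open ≤-Reasoning

affine-crossing : ∀ a b c {x y} → x ≤ y → a + b * x ≤ c → c < a + b * y →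
                  0ℚ < b × ∃[ z ] x ≤ z × z < y × a + b * z ≡ c
affine-crossing a b c {x} {y} x≤y below above with b ≤? 0ℚ
... | yes b≤0 = ⊥-elim (<-irrefl refl (<-≤-trans bx<by (*-monoˡ-≤-nonPos b {{nonPositive b≤0}} x≤y)))
  where bx<by = ≤-<-trans (p+q≤r⇒q≤r-p {a} below) (r<p+q⇒r-p<q {a} above)
... | no b≰0 = 0<b , z , x≤z , z<y , crosses
  where
    0<b : 0ℚ < b
    0<b = ≰⇒> b≰0
    instance
      b≢0 : NonZero b
      b≢0 = >-nonZero 0<b
    z : ℚ
    z = (c - a) ÷ b
    bz≡c-a : b * z ≡ c - a
    bz≡c-a = begin
      b * ((c - a) * 1/ b)  ≡⟨ cong (b *_) (*-comm (c - a) (1/ b)) ⟩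
      b * (1/ b * (c - a))  ≡⟨ *-assoc b (1/ b) (c - a) ⟨
      b * 1/ b * (c - a)    ≡⟨ cong (_* (c - a)) (*-inverseʳ b) ⟩
      1ℚ * (c - a)          ≡⟨ *-identityˡ (c - a) ⟩
      c - a                 ∎
      where open ≡-Reasoning
    x≤z : x ≤ z
    x≤z = *-cancelˡ-≤-pos b {{positive 0<b}} (subst (b * x ≤_) (sym bz≡c-a) (p+q≤r⇒q≤r-p {a} below))
    z<y : z < y
    z<y = *-cancelˡ-<-nonNeg b {{nonNegative (<⇒≤ 0<b)}} (subst (_< b * y) (sym bz≡c-a) (r<p+q⇒r-p<q {a} above))
    crosses : a + b * z ≡ c
    crosses = begin
      a + b * z    ≡⟨ cong (a +_) bz≡c-a ⟩
      a + (c - a)  ≡⟨ +-comm a (c - a) ⟩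
      c - a + a    ≡⟨ //-rightDividesˡ a c ⟩
      c            ∎
      where open ≡-Reasoning

sumOver-cong : ∀ {n} (V : Subset n) {f g : Fin n → ℚ} → (∀ i → f i ≡ g i) → sumOver V f ≡ sumOver V g
sumOver-cong V f≗g = cong sumℚ (tabulate-cong λ i → cong (λ x → if lookup V i then x else 0ℚ) (f≗g i))

sumOver-+ : ∀ {n} (V : Subset n) (f g : Fin n → ℚ) →
            sumOver V (λ i → f i + g i) ≡ sumOver V f + sumOver V g
sumOver-+ []          f g = sym (+-identityʳ 0ℚ)
sumOver-+ (true ∷ V)  f g = trans (cong (f zero + g zero +_) (sumOver-+ V (f ∘ suc) (g ∘ suc)))
                                  (interchange (f zero) (g zero) (sumOver V (f ∘ suc)) (sumOver V (g ∘ suc)))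
sumOver-+ (false ∷ V) f g = trans (cong (0ℚ +_) (sumOver-+ V (f ∘ suc) (g ∘ suc)))
                                  (interchange 0ℚ 0ℚ (sumOver V (f ∘ suc)) (sumOver V (g ∘ suc)))

sumOver-*ʳ : ∀ {n} (V : Subset n) (f : Fin n → ℚ) x → sumOver V (λ i → f i * x) ≡ sumOver V f * x
sumOver-*ʳ []          f x = sym (*-zeroˡ x)
sumOver-*ʳ (true ∷ V)  f x = trans (cong (f zero * x +_) (sumOver-*ʳ V (f ∘ suc) x))
                                   (sym (*-distribʳ-+ x (f zero) (sumOver V (f ∘ suc))))
sumOver-*ʳ (false ∷ V) f x = trans (cong₂ _+_ (sym (*-zeroˡ x)) (sumOver-*ʳ V (f ∘ suc) x))
                                   (sym (*-distribʳ-+ x 0ℚ (sumOver V (f ∘ suc))))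

sumOver≢0⇒nonzero-member : ∀ {n} (V : Subset n) (f : Fin n → ℚ) →
                           sumOver V f ≢ 0ℚ → ∃[ i ] i ∈ V × f i ≢ 0ℚ
sumOver≢0⇒nonzero-member []          f Σ≢0 = ⊥-elim (Σ≢0 refl)
sumOver≢0⇒nonzero-member (true ∷ V)  f Σ≢0 with f zero ≟ 0ℚ
... | no  f₀≢0 = zero , here , f₀≢0
... | yes f₀≡0 = map suc (map₁ there)
  (sumOver≢0⇒nonzero-member V (f ∘ suc) (Σ≢0 ∘ cong₂ _+_ f₀≡0))
sumOver≢0⇒nonzero-member (false ∷ V) f Σ≢0 = map suc (map₁ there)
  (sumOver≢0⇒nonzero-member V (f ∘ suc) (Σ≢0 ∘ cong (0ℚ +_)))

sumOver-[]≔ : ∀ {n} (V : Subset n) i (f : Fin n → ℚ) →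
              sumOver (V [ i ]≔ inside) f ≡ sumOver (V [ i ]≔ outside) f + f i
sumOver-[]≔ (_ ∷ V) zero    f = trans (+-comm (f zero) (sumOver V (f ∘ suc)))
                                      (cong (_+ f zero) (sym (+-identityˡ (sumOver V (f ∘ suc)))))
sumOver-[]≔ (b ∷ V) (suc i) f = trans (cong (head +_) (sumOver-[]≔ V i (f ∘ suc)))
                                      (sym (+-assoc head (sumOver (V [ i ]≔ outside) (f ∘ suc)) (f (suc i))))
  where head = if b then f zero else 0ℚ

∣[]≔inside∣ : ∀ {n} (V : Subset n) i → ∣ V [ i ]≔ inside ∣ ≡ suc ∣ V [ i ]≔ outside ∣
∣[]≔inside∣ (_ ∷ V)     zero    = refl
∣[]≔inside∣ (true ∷ V)  (suc i) = cong suc (∣[]≔inside∣ V i)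
∣[]≔inside∣ (false ∷ V) (suc i) = ∣[]≔inside∣ V i

x∈p⇒p[x]≔inside≡p : ∀ {n} {p : Subset n} {x} → x ∈ p → p [ x ]≔ inside ≡ p
x∈p⇒p[x]≔inside≡p here        = refl
x∈p⇒p[x]≔inside≡p (there x∈p) = cong (_ ∷_) (x∈p⇒p[x]≔inside≡p x∈p)

x∉p⇒p[x]≔outside≡p : ∀ {n} {p : Subset n} {x} → x ∉ p → p [ x ]≔ outside ≡ p
x∉p⇒p[x]≔outside≡p {p = true ∷ p}  {zero}  x∉p = ⊥-elim (x∉p here)
x∉p⇒p[x]≔outside≡p {p = false ∷ p} {zero}  _   = refl
x∉p⇒p[x]≔outside≡p {p = b ∷ p}     {suc x} x∉p = cong (b ∷_) (x∉p⇒p[x]≔outside≡p (x∉p ∘ there))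

x∉p⇒p⊂p[x]≔inside : ∀ {n} {p : Subset n} {x} → x ∉ p → p ⊂ p [ x ]≔ inside
x∉p⇒p⊂p[x]≔inside {p = p} {x} x∉p = p⊆p[x]≔inside , x , []≔-updates p x , x∉p
  where
    p⊆p[x]≔inside : p ⊆ p [ x ]≔ inside
    p⊆p[x]≔inside {y} y∈p with y Fin.≟ x
    ... | yes refl = []≔-updates p x
    ... | no  y≢x  = []≔-minimal p y x y≢x y∈p

lookup-cong-∈ : ∀ {n} {p : Subset n} {x y} → (x ∈ p → y ∈ p) → (y ∈ p → x ∈ p) → lookup p x ≡ lookup p y
lookup-cong-∈ {p = p} {x} {y} x∈⇒y∈ y∈⇒x∈ with lookup p x in px | lookup p y in py
... | true  | true  = refl
... | false | false = refl
... | true  | false = contradiction (trans (sym py) ([]=⇒lookup (x∈⇒y∈ (lookup⇒[]= x p px)))) λ ()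
... | false | true  = contradiction (trans (sym px) ([]=⇒lookup (y∈⇒x∈ (lookup⇒[]= y p py)))) λ ()

Concave : (ℕ → ℚ) → Set
Concave f = ∀ k → f (suc (suc k)) + f k ≤ f (suc k) + f (suc k)

*-concave : ∀ {c} (f : ℕ → ℚ) → 0ℚ ≤ c → Concave f → Concave (λ k → c * f k)
*-concave {c} f 0≤c f-concave k = begin
  c * f (suc (suc k)) + c * f k  ≡⟨ *-distribˡ-+ c (f (suc (suc k))) (f k) ⟨
  c * (f (suc (suc k)) + f k)    ≤⟨ *-monoˡ-≤-nonNeg c {{nonNegative 0≤c}} (f-concave k) ⟩
  c * (f (suc k) + f (suc k))    ≡⟨ *-distribˡ-+ c (f (suc k)) (f (suc k)) ⟩
  c * f (suc k) + c * f (suc k)  ∎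
  where open ≤-Reasoning

S-nonneg : ∀ {m} (s : Fin m → ℚ) → (∀ i → 0ℚ ≤ s i) → ∀ k → 0ℚ ≤ S s k
S-nonneg {zero}  s _   zero    = ≤-refl
S-nonneg {zero}  s _   (suc k) = ≤-refl
S-nonneg {suc m} s _   zero    = ≤-refl
S-nonneg {suc m} s 0≤s (suc k) = +-mono-≤ (0≤s zero) (S-nonneg (s ∘ suc) (0≤s ∘ suc) k)

S-tail-1≤head : ∀ {m} (s : Fin (suc m) → ℚ) → (∀ i → 0ℚ ≤ s i) → s Preserves Fin._≤_ ⟶ _≥_ →
                S (s ∘ suc) 1 ≤ s zero
S-tail-1≤head {zero}  s 0≤s _        = 0≤s zero
S-tail-1≤head {suc m} s _   antitone = ≤-trans (≤-reflexive (+-identityʳ (s (suc zero)))) (antitone z≤n)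

S-concave : ∀ {m} (s : Fin m → ℚ) → (∀ i → 0ℚ ≤ s i) → s Preserves Fin._≤_ ⟶ _≥_ → Concave (S s)
S-concave {zero}  s _   _        zero    = ≤-refl
S-concave {zero}  s _   _        (suc k) = ≤-refl
S-concave {suc m} s 0≤s antitone zero    = begin
  s zero + S (s ∘ suc) 1 + 0ℚ    ≡⟨ +-identityʳ (s zero + S (s ∘ suc) 1) ⟩
  s zero + S (s ∘ suc) 1         ≤⟨ +-monoʳ-≤ (s zero) (S-tail-1≤head s 0≤s antitone) ⟩
  s zero + s zero                ≡⟨ cong₂ _+_ (+-identityʳ (s zero)) (+-identityʳ (s zero)) ⟨
  (s zero + 0ℚ) + (s zero + 0ℚ)  ∎
  where open ≤-Reasoning
S-concave {suc m} s 0≤s antitone (suc k) = begin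
  (s₀ + S s′ (suc (suc k))) + (s₀ + S s′ k)  ≡⟨ interchange s₀ (S s′ (suc (suc k))) s₀ (S s′ k) ⟩
  (s₀ + s₀) + (S s′ (suc (suc k)) + S s′ k)  ≤⟨ +-monoʳ-≤ (s₀ + s₀) (S-concave s′ (0≤s ∘ suc) antitone′ k) ⟩
  (s₀ + s₀) + (S s′ (suc k) + S s′ (suc k))  ≡⟨ interchange s₀ s₀ (S s′ (suc k)) (S s′ (suc k)) ⟩
  (s₀ + S s′ (suc k)) + (s₀ + S s′ (suc k))  ∎
  where
    open ≤-Reasoning
    s₀ = s zero
    s′ = s ∘ suc
    antitone′ : s′ Preserves Fin._≤_ ⟶ _≥_
    antitone′ i≤j = antitone (ℕ.s≤s i≤j)

tight-absorbs-equal-rate :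
  ∀ {n} {R : Fin n → ℚ} {f : ℕ → ℚ} → Concave f → (∀ W → sumOver W R ≤ f ∣ W ∣) →
  ∀ {V u v} → sumOver V R ≡ f ∣ V ∣ → u ∈ V → v ∉ V → R u ≡ R v →
  sumOver (V [ v ]≔ inside) R ≡ f ∣ V [ v ]≔ inside ∣
tight-absorbs-equal-rate {R = R} {f} concave feasible {V} {u} {v} tight u∈V v∉V Ru≡Rv =
  ≤-antisym (feasible W) (begin
    f ∣ W ∣          ≡⟨ cong f ∣W∣≡2+k ⟩
    f (suc (suc k))  ≤⟨ marginal-bound ⟩
    f (suc k) + R u  ≡⟨ ΣW ⟨
    sumOver W R      ∎)
  where
    open ≤-Reasoning
    V⁻ = V [ u ]≔ outside
    W  = V [ v ]≔ inside
    k  = ∣ V⁻ ∣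
    ∣V∣≡1+k : ∣ V ∣ ≡ suc k
    ∣V∣≡1+k = trans (cong ∣_∣ (sym (x∈p⇒p[x]≔inside≡p u∈V))) (∣[]≔inside∣ V u)
    ∣W∣≡2+k : ∣ W ∣ ≡ suc (suc k)
    ∣W∣≡2+k = trans (∣[]≔inside∣ V v) (cong suc (trans (cong ∣_∣ (x∉p⇒p[x]≔outside≡p v∉V)) ∣V∣≡1+k))
    ΣV : sumOver V⁻ R + R u ≡ f (suc k)
    ΣV = begin-equality
      sumOver V⁻ R + R u           ≡⟨ sumOver-[]≔ V u R ⟨
      sumOver (V [ u ]≔ inside) R  ≡⟨ cong (λ X → sumOver X R) (x∈p⇒p[x]≔inside≡p u∈V) ⟩
      sumOver V R                  ≡⟨ tight ⟩
      f ∣ V ∣                      ≡⟨ cong f ∣V∣≡1+k ⟩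
      f (suc k)                    ∎
    ΣW : sumOver W R ≡ f (suc k) + R u
    ΣW = begin-equality
      sumOver W R                         ≡⟨ sumOver-[]≔ V v R ⟩
      sumOver (V [ v ]≔ outside) R + R v  ≡⟨ cong₂ _+_ (cong (λ X → sumOver X R) (x∉p⇒p[x]≔outside≡p v∉V))
                                                      (sym Ru≡Rv) ⟩
      sumOver V R + R u                   ≡⟨ cong (_+ R u) (trans tight (cong f ∣V∣≡1+k)) ⟩
      f (suc k) + R u                     ∎
    marginal-bound : f (suc (suc k)) ≤ f (suc k) + R u
    marginal-bound = +-cancelʳ-≤ (f k) (begin
      f (suc (suc k)) + f k               ≤⟨ concave k ⟩
      f (suc k) + f (suc k)               ≡⟨ cong (f (suc k) +_) ΣV ⟨
      f (suc k) + (sumOver V⁻ R + R u)    ≤⟨ +-monoʳ-≤ (f (suc k)) (+-monoˡ-≤ (R u) (feasible V⁻)) ⟩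
      f (suc k) + (f k + R u)             ≡⟨ x∙yz≈xz∙y (f (suc k)) (f k) (R u) ⟩
      f (suc k) + R u + f k               ∎)

module _ (I : Instance) where
  open Instance I

  capacity : ℕ → ℚ
  capacity k = γ * S speed k

  Feasible : State I → ℚ → Set
  Feasible st τ = ∀ W → sumOver W (rate I st τ) ≤ capacity ∣ W ∣

  NoTightBetween : State I → ℚ → ℚ → Set
  NoTightBetween st τ₀ τ = ∀ τ′ → τ₀ ≤ τ′ → τ′ < τ → ∀ V → HasUnfrozen I st V → ¬ Tight I st τ′ V

  MaximalTight : State I → ℚ → Subset n → Set
  MaximalTight st τ V = Tight I st τ V × (∀ W → V ⊂ W → ¬ Tight I st τ W)

  JobUniform : State I → Set
  JobUniform st = ∀ u v → job u ≡ job v → st u ≡ st v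

  offset : State I → Fin n → ℚ
  offset st i = maybe′ (λ μ → coef I i * μ) 0ℚ (st i)

  slope : State I → Fin n → ℚ
  slope st i = maybe′ (λ _ → 0ℚ) (coef I i) (st i)

  rate-affine : ∀ st τ i → rate I st τ i ≡ offset st i + slope st i * τ
  rate-affine st τ i with st i
  ... | just μ  = sym (trans (cong (coef I i * μ +_) (*-zeroˡ τ)) (+-identityʳ (coef I i * μ)))
  ... | nothing = sym (+-identityˡ (coef I i * τ))

  sumOver-rate-affine : ∀ st τ W →
                        sumOver W (rate I st τ) ≡ sumOver W (offset st) + sumOver W (slope st) * τ
  sumOver-rate-affine st τ W = begin
    sumOver W (rate I st τ)                                   ≡⟨ sumOver-cong W (rate-affine st τ) ⟩
    sumOver W (λ i → offset st i + slope st i * τ)            ≡⟨ sumOver-+ W (offset st) (λ i → slope st i * τ) ⟩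
    sumOver W (offset st) + sumOver W (λ i → slope st i * τ)  ≡⟨ cong (sumOver W (offset st) +_)
                                                                    (sumOver-*ʳ W (slope st) τ) ⟩
    sumOver W (offset st) + sumOver W (slope st) * τ          ∎
    where open ≡-Reasoning

  slope≢0⇒unfrozen : ∀ st {i} → slope st i ≢ 0ℚ → st i ≡ nothing
  slope≢0⇒unfrozen st {i} slope≢0 with st i
  ... | just _  = ⊥-elim (slope≢0 refl)
  ... | nothing = refl

  overfull⇒tight-earlier : ∀ {st τ₀ τ} W → Feasible st τ₀ → τ₀ ≤ τ →
                           capacity ∣ W ∣ < sumOver W (rate I st τ) →
                           ∃[ τ′ ] τ₀ ≤ τ′ × τ′ < τ × HasUnfrozen I st W × Tight I st τ′ W
  overfull⇒tight-earlier {st} {τ₀} {τ} W feasible τ₀≤τ overfull =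
    let (0<B , τ′ , τ₀≤τ′ , τ′<τ , crosses) = affine-crossing A B (capacity ∣ W ∣) τ₀≤τ below above
    in  τ′ , τ₀≤τ′ , τ′<τ , unfrozen 0<B , trans (sumOver-rate-affine st τ′ W) crosses
    where
      A = sumOver W (offset st)
      B = sumOver W (slope st)
      below : A + B * τ₀ ≤ capacity ∣ W ∣
      below = subst (_≤ capacity ∣ W ∣) (sumOver-rate-affine st τ₀ W) (feasible W)
      above : capacity ∣ W ∣ < A + B * τ
      above = subst (capacity ∣ W ∣ <_) (sumOver-rate-affine st τ W) overfull
      unfrozen : 0ℚ < B → HasUnfrozen I st W
      unfrozen 0<B = map₂ (map₂ (slope≢0⇒unfrozen st))
                          (sumOver≢0⇒nonzero-member W (slope st) (≢-sym (<⇒≢ 0<B)))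

  Feasible-until : ∀ {st τ₀ τ} → Feasible st τ₀ → τ₀ ≤ τ → NoTightBetween st τ₀ τ → Feasible st τ
  Feasible-until {st} {τ₀} {τ} feasible τ₀≤τ no-tight W with sumOver W (rate I st τ) ≤? capacity ∣ W ∣
  ... | yes fits     = fits
  ... | no  overfull =
    let (τ′ , τ₀≤τ′ , τ′<τ , unfrozen , tight) = overfull⇒tight-earlier W feasible τ₀≤τ (≰⇒> overfull)
    in  ⊥-elim (no-tight τ′ τ₀≤τ′ τ′<τ W unfrozen tight)

  rate-freeze : ∀ st V τ i → rate I (freeze I st V τ) τ i ≡ rate I st τ i
  rate-freeze st V τ i with st i
  ... | just _  = refl
  ... | nothing with lookup V i
  ...   | true  = refl
  ...   | false = refl

  Feasible-freeze : ∀ {st τ} V → Feasible st τ → Feasible (freeze I st V τ) τ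
  Feasible-freeze {st} {τ} V feasible W =
    subst (_≤ capacity ∣ W ∣) (sym (sumOver-cong W (rate-freeze st V τ))) (feasible W)

  Feasible-initial : (∀ k → 0ℚ ≤ capacity k) → Feasible (initial I) 0ℚ
  Feasible-initial 0≤capacity W = begin
    sumOver W (λ i → coef I i * 0ℚ)  ≡⟨ sumOver-*ʳ W (coef I) 0ℚ ⟩
    sumOver W (coef I) * 0ℚ          ≡⟨ *-zeroʳ (sumOver W (coef I)) ⟩
    0ℚ                               ≤⟨ 0≤capacity ∣ W ∣ ⟩
    capacity ∣ W ∣                   ∎
    where open ≤-Reasoning

  rate-cong : ∀ st τ {u v} → job u ≡ job v → st u ≡ st v → rate I st τ u ≡ rate I st τ v
  rate-cong st τ = cong₂ (λ j x → weight j * inv (alive I j) * maybe (λ μ → μ) τ x)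

  freeze-cong : ∀ {st u v} V τ → st u ≡ st v → (st u ≡ nothing → lookup V u ≡ lookup V v) →
                freeze I st V τ u ≡ freeze I st V τ v
  freeze-cong {st} {u} {v} V τ same-state same-lookup with st u | st v
  ... | just _  | just _  = same-state
  ... | nothing | nothing = cong (λ b → if b then just τ else nothing) (same-lookup refl)
  ... | just _  | nothing = contradiction same-state λ ()
  ... | nothing | just _  = contradiction same-state λ ()

  module _ (capacity-concave : Concave capacity) where

    MaximalTight-closed : ∀ {st τ V u v} → Feasible st τ → MaximalTight st τ V →
                          job u ≡ job v → st u ≡ nothing → st v ≡ nothing → u ∈ V → v ∈ V
    MaximalTight-closed {st} {τ} {V} {v = v} feasible (tight , maximal) same-job u-unfrozen v-unfrozen u∈V
      with v ∈? V
    ... | yes v∈V = v∈V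
    ... | no  v∉V = ⊥-elim (maximal (V [ v ]≔ inside) (x∉p⇒p⊂p[x]≔inside v∉V) V+v-tight)
      where
        V+v-tight : Tight I st τ (V [ v ]≔ inside)
        V+v-tight = tight-absorbs-equal-rate {R = rate I st τ} {capacity} capacity-concave feasible tight u∈V v∉V
                        (rate-cong st τ same-job (trans u-unfrozen (sym v-unfrozen)))

    JobUniform-freeze : ∀ {st τ V} → Feasible st τ → MaximalTight st τ V →
                        JobUniform st → JobUniform (freeze I st V τ)
    JobUniform-freeze {st} {V = V} feasible maximal uniform u v same-job =
      freeze-cong V _ (uniform u v same-job) λ u-unfrozen →
        let v-unfrozen = trans (sym (uniform u v same-job)) u-unfrozen
        in lookup-cong-∈ (closed same-job u-unfrozen v-unfrozen) (closed (sym same-job) v-unfrozen u-unfrozen)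
      where
        closed : ∀ {u v} → job u ≡ job v → st u ≡ nothing → st v ≡ nothing → u ∈ V → v ∈ V
        closed = MaximalTight-closed feasible maximal

    JobUniform-run : ∀ {st τ₀ fin} → Feasible st τ₀ → JobUniform st → Run I st τ₀ fin → JobUniform fin
    JobUniform-run _        uniform (done _) = uniform
    JobUniform-run {st} feasible uniform (next (step τ V τ₀≤τ _ tight no-tight maximal) run) =
      JobUniform-run (Feasible-freeze {st} V feasible-at-τ)
                     (JobUniform-freeze feasible-at-τ (tight , maximal) uniform) run
      where
        feasible-at-τ : Feasible st τ
        feasible-at-τ = Feasible-until feasible τ₀≤τ no-tight

lemma2 : (I : Instance) → ValidInstance I →
    (fin : State I) → Run I (initial I) 0ℚ fin →
    (u v : Fin (Instance.n I)) → Instance.job I u ≡ Instance.job I v →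
    (fin u ≡ fin v) × (∀ τ → rate I fin τ u ≡ rate I fin τ v)
lemma2 I (0<speed , antitone , _ , 1≤γ) fin run u v same-job =
  same-state , λ τ → rate-cong I fin τ same-job same-state
  where
    open Instance I
    0≤γ : 0ℚ ≤ γ
    0≤γ = ≤-trans (nonNegative⁻¹ 1ℚ) 1≤γ
    0≤speed : ∀ i → 0ℚ ≤ speed i
    0≤speed i = <⇒≤ (0<speed i)
    0≤capacity : ∀ k → 0ℚ ≤ capacity I k
    0≤capacity k = ≤-trans (≤-reflexive (sym (*-zeroʳ γ)))
                           (*-monoˡ-≤-nonNeg γ {{nonNegative 0≤γ}} (S-nonneg speed 0≤speed k))
    capacity-concave : Concave (capacity I)
    capacity-concave = *-concave (S speed) 0≤γ (S-concave speed 0≤speed λ {i} {k} → antitone i k)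
    same-state : fin u ≡ fin v
    same-state = JobUniform-run I capacity-concave (Feasible-initial I 0≤capacity) (λ _ _ _ → refl) run u v same-job
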